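{- Let $G$ be a complete $k$-partite graph and $H$ a complete $l$-partite graph. If $X_G=X_H$, then $G$ and $H$ are isomorphic.
   Context: A graph $G=(V,E)$ is complete $k$-partite if there is a partition of $V$ into $k$ blocks $V_1,\ldots,V_k$ such that $E=\{\{u,v\}\mid u\in V_i,v\in V_j,i\neq j\}$. $X_G=\sum_f\prod_{v\in V}x_{f(v)}$, summed over all proper colorings $f:V\to\mathbb{N}$, is the chromatic symmetric function. -}

module Defs where

open import Data.Nat using (ℕ; zero; suc; _≡ᵇ_)
open import Data.Bool using (Bool; true; false; not; _∨_; _∧_)
open import Data.Bool.Properties using (T?)
open import Data.Fin using (Fin; zero; suc; _≟_)
open import Data.List using (List; []; _∷_; length; filter; map; concatMap; allFin)
open import Data.Bool.ListAction using (and)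
open import Data.Vec using (Vec; lookup)
open import Data.Product using (Σ; ∃; _×_; _,_)
open import Relation.Nullary using (¬_; does)
open import Relation.Binary.PropositionalEquality using (_≡_; _≢_)
open import Function.Bundles using (_↔_; Inverse)

allᵇ : {A : Set} → (A → Bool) → List A → Bool
allᵇ p xs = and (map p xs)

record Graph : Set where
  field
    n     : ℕ
    adj   : Fin n → Fin n → Bool
    sym   : ∀ u v → adj u v ≡ adj v u
    irrefl : ∀ u → adj u u ≡ false
open Graph public

IsCompleteMultipartite : ℕ → Graph → Set
IsCompleteMultipartite k G =
  Σ (Fin (n G) → Fin k) λ b →
    (∀ i → ∃ λ v → b v ≡ i) ×
    (∀ u v → (adj G u v ≡ true → b u ≢ b v) × (b u ≢ b v → adj G u v ≡ true))

Isomorphic : Graph → Graph → Set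
Isomorphic G H =
  Σ (Fin (n G) ↔ Fin (n H)) λ σ →
    ∀ u v → adj G u v ≡ adj H (Inverse.to σ u) (Inverse.to σ v)

allFuns : (n m : ℕ) → List (Fin n → Fin m)
allFuns zero m = (λ ()) ∷ []
allFuns (suc n) m =
  concatMap (λ c → map (λ f → λ { zero → c ; (suc i) → f i }) (allFuns n m)) (allFin m)

_==ᶠ_ : ∀ {m} → Fin m → Fin m → Bool
a ==ᶠ b = does (a ≟ b)

isProper : (G : Graph) {m : ℕ} → (Fin (n G) → Fin m) → Bool
isProper G f = allᵇ (λ u → allᵇ (λ v → not (adj G u v) ∨ not (f u ==ᶠ f v)) (allFin (n G))) (allFin (n G))

colorCount : ∀ {k m} → (Fin k → Fin m) → Fin m → ℕ
colorCount {k} f i = length (filter (λ v → f v ≟ i) (allFin k))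

-- f has color multiplicities α (i.e. ∏_v x_{f(v)} = x^α)
hasType : ∀ {k m} → (Fin k → Fin m) → Vec ℕ m → Bool
hasType {m = m} f α = allᵇ (λ i → colorCount f i ≡ᵇ lookup α i) (allFin m)

-- Coefficient of the monomial x_0^{α_0} ⋯ x_{m-1}^{α_{m-1}} in X_G:
-- the number of proper colorings f : V → ℕ with |f⁻¹(i)| = α_i for all i
-- (colors ≥ m have exponent 0, so such f take values in Fin m).
coeffX : (G : Graph) {m : ℕ} → Vec ℕ m → ℕ
coeffX G {m} α = length (filter (λ f → T? (isProper G f ∧ hasType f α)) (allFuns (n G) m))


-- X_G = X_H as formal power series: all monomial coefficients agree.
-- Every monomial is x_0^{α_0}⋯x_{m-1}^{α_{m-1}} for some m and α.
SameCSF : Graph → Graph → Set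
SameCSF G H = ∀ m (α : Vec ℕ m) → coeffX G α ≡ coeffX H α

-- The block map of a complete k-partite graph G is a proper k-coloring whose color classes
-- are the blocks, so X_G contains the monomial recording the block sizes; hence so does X_H,
-- i.e. H has a proper k-coloring with the same class sizes.  A proper coloring of a complete
-- multipartite graph gives different blocks different colors, so it uses at least as many
-- colors as there are blocks; by symmetry k = l, and then every block is monochromatic, so the
-- color classes of that coloring are exactly the blocks of H.  Matching up classes of equal
-- size gives the isomorphism.
module Submission where

open import Defs hiding (sym)
open import Data.Nat using (ℕ; zero; suc; _+_; _≤_; _<_; z<s; _≡ᵇ_)
open import Data.Nat.Properties
  using (+-cancelˡ-≡; +-commutativeSemigroup; <-irrefl; ≤-trans; ≡ᵇ⇒≡; ≡⇒≡ᵇ)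
open import Algebra.Properties.CommutativeSemigroup +-commutativeSemigroup using (x∙yz≈y∙xz)
open import Data.Bool using (Bool; true; false; not; _∧_; _∨_; if_then_else_; T)
open import Data.Bool.Properties using (T?; T-∧; ¬-not)
open import Data.Fin using (Fin; zero; suc; _≟_; punchIn)
open import Data.Fin.Properties using (any?; injective⇒≤)
open import Data.Fin.Permutation using (Permutation; _⟨$⟩ʳ_; insert; insert-punchIn)
import Data.Fin.Permutation as Permutation
open import Data.List using (_∷_; length; filter; allFin; tabulate)
open import Data.List.Relation.Unary.Any using (Any; here)
import Data.List.Relation.Unary.Any as Any
open import Data.List.Relation.Unary.Any.Properties using (map⁺; concatMap⁺)
import Data.List.Relation.Unary.All as All
open import Data.List.Relation.Unary.All.Properties using (all⁺; all⁻)
open import Data.List.Membership.Propositional.Properties using (∈-allFin; ∈-filter⁻)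
open import Data.List.Properties using (filter-some)
open import Data.Vec using (Vec; lookup)
import Data.Vec as Vec
open import Data.Vec.Properties using (lookup∘tabulate)
import Data.Vec.Functional as Vector
open import Data.Product using (Σ; ∃-syntax; _×_; _,_; proj₁; proj₂)
open import Relation.Nullary using (does; yes; no; contradiction)
open import Relation.Nullary.Decidable using (does-⇔)
open import Relation.Binary.PropositionalEquality
  using (_≡_; _≢_; _≗_; refl; sym; trans; cong; cong₂; subst; module ≡-Reasoning)
open import Function using (_∘_; _⇔_; mk⇔; Equivalence)
open import Function.Definitions using (Injective)

private
  variable
    k l m : ℕ

indicator : Fin k → Fin k → ℕ
indicator c d = if does (c ≟ d) then 1 else 0

fibreSize : ∀ {n} → (Fin n → Fin k) → Fin k → ℕ
fibreSize {n = zero}  b d = 0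
fibreSize {n = suc n} b d = indicator (b zero) d + fibreSize (b ∘ suc) d

indicator-self : (c : Fin k) → indicator c c ≡ 1
indicator-self c with c ≟ c
... | yes _  = refl
... | no c≢c = contradiction refl c≢c

filter-tabulate≡fibreSize : ∀ {n} {A : Set} (f : A → Fin k) (g : Fin n → A) d →
  length (filter (λ x → f x ≟ d) (tabulate g)) ≡ fibreSize (f ∘ g) d
filter-tabulate≡fibreSize {n = zero}  f g d = refl
filter-tabulate≡fibreSize {n = suc n} f g d with f (g zero) ≟ d
... | yes _ = cong suc (filter-tabulate≡fibreSize f (g ∘ suc) d)
... | no _  = filter-tabulate≡fibreSize f (g ∘ suc) d

colorCount≡fibreSize : ∀ {n} (b : Fin n → Fin k) d → colorCount b d ≡ fibreSize b d
colorCount≡fibreSize b = filter-tabulate≡fibreSize b (λ x → x)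

fibreSize-cong : ∀ {n} {b b′ : Fin n → Fin k} → b ≗ b′ → ∀ d → fibreSize b d ≡ fibreSize b′ d
fibreSize-cong {n = zero}  b≗b′ d = refl
fibreSize-cong {n = suc n} b≗b′ d =
  cong₂ _+_ (cong (λ c → indicator c d) (b≗b′ zero)) (fibreSize-cong (b≗b′ ∘ suc) d)

fibreSize-punchIn : ∀ {n} (b : Fin (suc n) → Fin k) j d →
  fibreSize b d ≡ indicator (b j) d + fibreSize (b ∘ punchIn j) d
fibreSize-punchIn b zero d = refl
fibreSize-punchIn {n = suc n} b (suc j) d = begin
  indicator (b zero) d + fibreSize (b ∘ suc) d
    ≡⟨ cong (indicator (b zero) d +_) (fibreSize-punchIn (b ∘ suc) j d) ⟩
  indicator (b zero) d + (indicator (b (suc j)) d + fibreSize (b ∘ suc ∘ punchIn j) d)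
    ≡⟨ x∙yz≈y∙xz (indicator (b zero) d) (indicator (b (suc j)) d) _ ⟩
  indicator (b (suc j)) d + (indicator (b zero) d + fibreSize (b ∘ suc ∘ punchIn j) d) ∎
  where open ≡-Reasoning

fibreSize-image-pos : ∀ {n} (b : Fin n → Fin k) j → 0 < fibreSize b (b j)
fibreSize-image-pos {n = suc n} b j =
  subst (0 <_) (sym (trans (fibreSize-punchIn b j (b j))
                           (cong (_+ fibreSize (b ∘ punchIn j) (b j)) (indicator-self (b j)))))
        z<s

fibreSize-pos⇒∈image : ∀ {n} (b : Fin n → Fin k) d → 0 < fibreSize b d → ∃[ j ] b j ≡ d
fibreSize-pos⇒∈image {n = suc n} b d pos with b zero ≟ d
... | yes b₀≡d = zero , b₀≡d
... | no _ with fibreSize-pos⇒∈image (b ∘ suc) d pos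
...   | j , bj≡d = suc j , bj≡d

sameFibreSizes⇒permutation : ∀ {n n′} (b : Fin n → Fin k) (b′ : Fin n′ → Fin k) →
  (∀ d → fibreSize b d ≡ fibreSize b′ d) →
  Σ (Permutation n n′) λ σ → ∀ x → b′ (σ ⟨$⟩ʳ x) ≡ b x
sameFibreSizes⇒permutation {n = zero} {zero} b b′ same = Permutation.id {0} , λ ()
sameFibreSizes⇒permutation {n = zero} {suc n′} b b′ same =
  contradiction (subst (0 <_) (sym (same (b′ zero))) (fibreSize-image-pos b′ zero)) λ ()
sameFibreSizes⇒permutation {n = suc n} {zero} b b′ same =
  contradiction (subst (0 <_) (same (b zero)) (fibreSize-image-pos b zero)) λ ()
sameFibreSizes⇒permutation {n = suc n} {suc n′} b b′ same = σ , b′∘σ≗b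
  where
  j-hit : ∃[ j ] b′ j ≡ b zero
  j-hit = fibreSize-pos⇒∈image b′ (b zero) (subst (0 <_) (same (b zero)) (fibreSize-image-pos b zero))
  j : Fin (suc n′)
  j = proj₁ j-hit

  sameRest : ∀ d → fibreSize (b ∘ suc) d ≡ fibreSize (b′ ∘ punchIn j) d
  sameRest d = +-cancelˡ-≡ (indicator (b zero) d) _ _ (begin
    fibreSize b d                                              ≡⟨ same d ⟩
    fibreSize b′ d                                             ≡⟨ fibreSize-punchIn b′ j d ⟩
    indicator (b′ j) d + fibreSize (b′ ∘ punchIn j) d          ≡⟨ cong (λ c → indicator c d + fibreSize (b′ ∘ punchIn j) d) (proj₂ j-hit) ⟩
    indicator (b zero) d + fibreSize (b′ ∘ punchIn j) d        ∎)
    where open ≡-Reasoning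

  rest : Σ (Permutation n n′) λ π → ∀ x → b′ (punchIn j (π ⟨$⟩ʳ x)) ≡ b (suc x)
  rest = sameFibreSizes⇒permutation (b ∘ suc) (b′ ∘ punchIn j) sameRest

  σ : Permutation (suc n) (suc n′)
  σ = insert zero j (proj₁ rest)

  b′∘σ≗b : ∀ x → b′ (σ ⟨$⟩ʳ x) ≡ b x
  b′∘σ≗b zero    = proj₂ j-hit
  b′∘σ≗b (suc x) = trans (cong b′ (insert-punchIn zero j (proj₁ rest) x)) (proj₂ rest x)

sameColorCounts⇒permutation : ∀ {n n′} (b : Fin n → Fin k) (b′ : Fin n′ → Fin k) →
  (∀ d → colorCount b d ≡ colorCount b′ d) →
  Σ (Permutation n n′) λ σ → ∀ x → b′ (σ ⟨$⟩ʳ x) ≡ b x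
sameColorCounts⇒permutation b b′ same = sameFibreSizes⇒permutation b b′ λ d →
  trans (sym (colorCount≡fibreSize b d)) (trans (same d) (colorCount≡fibreSize b′ d))

injective⇒surjective : {h : Fin l → Fin k} → Injective _≡_ _≡_ h → k ≤ l → ∀ c → ∃[ j ] h j ≡ c
injective⇒surjective {l} {h = h} h-inj k≤l c with any? (λ j → h j ≟ c)
... | yes hit = hit
... | no c∉image = contradiction (≤-trans (injective⇒≤ c∷h-inj) k≤l) (<-irrefl refl)
  where
  c∷h-inj : Injective _≡_ _≡_ (c Vector.∷ h)
  c∷h-inj {zero}  {zero}  _   = refl
  c∷h-inj {zero}  {suc j} c≡h = contradiction (j , sym c≡h) c∉image
  c∷h-inj {suc i} {zero}  h≡c = contradiction (i , h≡c) c∉image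
  c∷h-inj {suc i} {suc j} h≡h = cong suc (h-inj h≡h)

Proper : (G : Graph) → (Fin (n G) → Fin m) → Set
Proper G f = ∀ u v → adj G u v ≡ true → f u ≢ f v

HasType : ∀ {n} → (Fin n → Fin m) → Vec ℕ m → Set
HasType f α = ∀ i → colorCount f i ≡ lookup α i

T-isProper : (G : Graph) (f : Fin (n G) → Fin m) → T (isProper G f) ⇔ Proper G f
T-isProper G f = mk⇔
  (λ t u v → Equivalence.to (T-edgeOK u v)
     (All.lookup (all⁺ (edgeOK u) _ (All.lookup (all⁺ edgesOK _ t) (∈-allFin u))) (∈-allFin v)))
  (λ proper → all⁻ edgesOK (All.tabulate {xs = allFin (n G)} λ {u} _ →
     all⁻ (edgeOK u) (All.tabulate {xs = allFin (n G)} λ {v} _ →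
       Equivalence.from (T-edgeOK u v) (proper u v))))
  where
  edgeOK : Fin (n G) → Fin (n G) → Bool
  edgeOK u v = not (adj G u v) ∨ not (f u ==ᶠ f v)

  edgesOK : Fin (n G) → Bool
  edgesOK u = allᵇ (edgeOK u) (allFin (n G))

  T-edgeOK : ∀ u v → T (edgeOK u v) ⇔ (adj G u v ≡ true → f u ≢ f v)
  T-edgeOK u v with adj G u v | f u ≟ f v
  ... | false | _         = mk⇔ (λ _ ()) _
  ... | true  | yes fu≡fv = mk⇔ (λ ()) (λ proper → proper refl fu≡fv)
  ... | true  | no fu≢fv  = mk⇔ (λ _ _ → fu≢fv) _

T-hasType : ∀ {n} (f : Fin n → Fin m) α → T (hasType f α) ⇔ HasType f α
T-hasType {m = m} f α = mk⇔
  (λ t i → ≡ᵇ⇒≡ _ _ (All.lookup (all⁺ typeOK (allFin m) t) (∈-allFin i)))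
  (λ type → all⁻ typeOK (All.tabulate {xs = allFin m} λ {i} _ → ≡⇒≡ᵇ _ _ (type i)))
  where
  typeOK : Fin m → Bool
  typeOK i = colorCount f i ≡ᵇ lookup α i

allFuns-complete : ∀ n m (f : Fin n → Fin m) → Any (_≗ f) (allFuns n m)
allFuns-complete zero    m f = here (λ ())
allFuns-complete (suc n) m f = concatMap⁺ _ (Any.map
  (λ { refl → map⁺ (Any.map (λ g≗f → λ { zero → refl ; (suc i) → g≗f i }) (allFuns-complete n m (f ∘ suc))) })
  (∈-allFin (f zero)))

Proper-resp-≗ : (G : Graph) {f g : Fin (n G) → Fin m} → f ≗ g → Proper G g → Proper G f
Proper-resp-≗ G f≗g proper u v uv fu≡fv = proper u v uv (trans (sym (f≗g u)) (trans fu≡fv (f≗g v)))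

HasType-resp-≗ : ∀ {n} {f g : Fin n → Fin m} (α : Vec ℕ m) → f ≗ g → HasType g α → HasType f α
HasType-resp-≗ {f = f} {g} α f≗g type i = begin
  colorCount f i ≡⟨ colorCount≡fibreSize f i ⟩
  fibreSize f i  ≡⟨ fibreSize-cong f≗g i ⟩
  fibreSize g i  ≡⟨ colorCount≡fibreSize g i ⟨
  colorCount g i ≡⟨ type i ⟩
  lookup α i     ∎
  where open ≡-Reasoning

coeffX-pos⇔∃proper : (G : Graph) (α : Vec ℕ m) → 0 < coeffX G α ⇔ (∃[ f ] Proper G f × HasType f α)
coeffX-pos⇔∃proper {m} G α = mk⇔ witness count
  where
  P : (Fin (n G) → Fin m) → Bool
  P f = isProper G f ∧ hasType f α

  T-P : ∀ f → T (P f) ⇔ (Proper G f × HasType f α)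
  T-P f = mk⇔
    (λ t → let tp , th = Equivalence.to T-∧ t in
           Equivalence.to (T-isProper G f) tp , Equivalence.to (T-hasType f α) th)
    (λ (proper , type) →
           Equivalence.from T-∧ (Equivalence.from (T-isProper G f) proper , Equivalence.from (T-hasType f α) type))

  witness : 0 < coeffX G α → ∃[ f ] Proper G f × HasType f α
  witness pos with filter (T? ∘ P) (allFuns (n G) m) in accepted
  ... | f ∷ _ = f , Equivalence.to (T-P f)
    (proj₂ (∈-filter⁻ (T? ∘ P) {xs = allFuns (n G) m} (subst (Any (f ≡_)) (sym accepted) (here refl))))

  count : ∃[ f ] Proper G f × HasType f α → 0 < coeffX G α
  count (f , proper , type) = filter-some (T? ∘ P) {xs = allFuns (n G) m} (Any.map
    (λ g≗f → Equivalence.from (T-P _) (Proper-resp-≗ G g≗f proper , HasType-resp-≗ α g≗f type))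
    (allFuns-complete (n G) m f))

colorType : ∀ {n} → (Fin n → Fin k) → Vec ℕ k
colorType g = Vec.tabulate (colorCount g)

HasType⇔sameColorCounts : ∀ {n n′} (f : Fin n′ → Fin k) (g : Fin n → Fin k) →
  HasType f (colorType g) ⇔ (∀ i → colorCount f i ≡ colorCount g i)
HasType⇔sameColorCounts f g = mk⇔
  (λ type i → trans (type i) (lookup∘tabulate (colorCount g) i))
  (λ same i → trans (same i) (sym (lookup∘tabulate (colorCount g) i)))

sameCSF⇒proper-sameColorCounts : (G H : Graph) → SameCSF G H →
  (g : Fin (n G) → Fin k) → Proper G g →
  ∃[ f ] Proper H f × (∀ i → colorCount f i ≡ colorCount g i)
sameCSF⇒proper-sameColorCounts {k} G H same g proper
  with Equivalence.to (coeffX-pos⇔∃proper H (colorType g))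
         (subst (0 <_) (same k (colorType g))
           (Equivalence.from (coeffX-pos⇔∃proper G (colorType g))
             (g , proper , Equivalence.from (HasType⇔sameColorCounts g g) (λ _ → refl))))
... | f , f-proper , f-type = f , f-proper , Equivalence.to (HasType⇔sameColorCounts f g) f-type

IsBlockMap : (G : Graph) → (Fin (n G) → Fin l) → Set
IsBlockMap G b = ∀ u v → (adj G u v ≡ true → b u ≢ b v) × (b u ≢ b v → adj G u v ≡ true)

adj≡differentBlocks : (G : Graph) {b : Fin (n G) → Fin l} → IsBlockMap G b →
  ∀ u v → adj G u v ≡ not (b u ==ᶠ b v)
adj≡differentBlocks G {b} blocks u v with b u ≟ b v
... | yes bu≡bv = ¬-not λ uv → proj₁ (blocks u v) uv bu≡bv
... | no bu≢bv  = proj₂ (blocks u v) bu≢bv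

blockMap-proper : (G : Graph) {b : Fin (n G) → Fin l} → IsBlockMap G b → Proper G b
blockMap-proper G blocks u v = proj₁ (blocks u v)

module ProperColoring (H : Graph) {b : Fin (n H) → Fin l}
  (b-onto : ∀ j → ∃[ v ] b v ≡ j) (blocks : IsBlockMap H b)
  {f : Fin (n H) → Fin k} (proper : Proper H f) where

  sameColor⇒sameBlock : ∀ u v → f u ≡ f v → b u ≡ b v
  sameColor⇒sameBlock u v fu≡fv with b u ≟ b v
  ... | yes bu≡bv = bu≡bv
  ... | no bu≢bv  = contradiction fu≡fv (proper u v (proj₂ (blocks u v) bu≢bv))

  representative : Fin l → Fin (n H)
  representative j = proj₁ (b-onto j)

  blockColor : Fin l → Fin k
  blockColor = f ∘ representative

  blockColor-injective : Injective _≡_ _≡_ blockColor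
  blockColor-injective {i} {j} same =
    trans (sym (proj₂ (b-onto i))) (trans (sameColor⇒sameBlock _ _ same) (proj₂ (b-onto j)))

  blocks≤colors : l ≤ k
  blocks≤colors = injective⇒≤ blockColor-injective

  module _ (colors≤blocks : k ≤ l) where

    color≡blockColor : ∀ u → f u ≡ blockColor (b u)
    color≡blockColor u with injective⇒surjective blockColor-injective colors≤blocks (f u)
    ... | j , hit = subst (λ i → f u ≡ blockColor i)
                          (trans (sym (proj₂ (b-onto j))) (sameColor⇒sameBlock _ _ hit)) (sym hit)

    sameColor⇔sameBlock : ∀ u v → f u ≡ f v ⇔ b u ≡ b v
    sameColor⇔sameBlock u v = mk⇔ (sameColor⇒sameBlock u v)
      λ bu≡bv → trans (color≡blockColor u) (trans (cong blockColor bu≡bv) (sym (color≡blockColor v)))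

sameBlocks⇒isomorphic : (G H : Graph) {bG : Fin (n G) → Fin k} {bH : Fin (n H) → Fin l} →
  IsBlockMap G bG → IsBlockMap H bH → (σ : Permutation (n G) (n H)) →
  (∀ u v → bG u ≡ bG v ⇔ bH (σ ⟨$⟩ʳ u) ≡ bH (σ ⟨$⟩ʳ v)) → Isomorphic G H
sameBlocks⇒isomorphic G H {bG} {bH} bG-blocks bH-blocks σ sameBlock⇔ = σ , λ u v → begin
  adj G u v                              ≡⟨ adj≡differentBlocks G bG-blocks u v ⟩
  not (bG u ==ᶠ bG v)                    ≡⟨ cong not (does-⇔ (sameBlock⇔ u v) (bG u ≟ bG v) (bH _ ≟ bH _)) ⟩
  not (bH (σ ⟨$⟩ʳ u) ==ᶠ bH (σ ⟨$⟩ʳ v))  ≡⟨ adj≡differentBlocks H bH-blocks _ _ ⟨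
  adj H (σ ⟨$⟩ʳ u) (σ ⟨$⟩ʳ v)            ∎
  where open ≡-Reasoning

mainTheorem5 : (k l : ℕ) (G H : Graph) →
    IsCompleteMultipartite k G → IsCompleteMultipartite l H →
    SameCSF G H → Isomorphic G H
mainTheorem5 k l G H (bG , bG-onto , bG-blocks) (bH , bH-onto , bH-blocks) same
  with sameCSF⇒proper-sameColorCounts G H same bG (blockMap-proper G bG-blocks)
     | sameCSF⇒proper-sameColorCounts H G (λ m α → sym (same m α)) bH (blockMap-proper H bH-blocks)
... | f , f-proper , f-counts | g , g-proper , _
  with sameColorCounts⇒permutation bG f (λ d → sym (f-counts d))
... | σ , f∘σ≗bG = sameBlocks⇒isomorphic G H bG-blocks bH-blocks σ λ u v → mk⇔
    (λ same → Equivalence.to (sameColor⇔sameBlock k≤l _ _) (trans (f∘σ≗bG u) (trans same (sym (f∘σ≗bG v)))))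
    (λ same → trans (sym (f∘σ≗bG u)) (trans (Equivalence.from (sameColor⇔sameBlock k≤l _ _) same) (f∘σ≗bG v)))
  where
  k≤l : k ≤ l
  k≤l = ProperColoring.blocks≤colors G bG-onto bG-blocks g-proper

  open ProperColoring H bH-onto bH-blocks f-proper using (sameColor⇔sameBlock)
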